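{- Let $n$ be a natural number and $k$ a positive integer. Let $\mathcal{D}_n=\{2^{n-m}\cdot\mathsf{C}_{2^m}: 0\le m\le n,\ m\text{ even}\}$ and $\mathcal{D}_n'=\{2^{n-m}\cdot\mathsf{C}_{2^m}: 0\le m\le n,\ m\text{ odd}\}$. Then $\mathcal{D}_n$ and $\mathcal{D}_n'$ can be separated by an adaptive left $k$-query algorithm over $\mathbb{N}$ if and only if $k\ge\log_2(n+1)$.
   Context: Digraphs are finite structures $(V,R)$, $V\ne\varnothing$, $R\subseteq V\times V$; $\mathsf{FIN}$ denotes the class of all digraphs; $\hom(F,D)$ is the number of homomorphisms $F\to D$. $\mathsf{C}_p$ is the directed cycle of length $p$ and $r\cdot H$ the disjoint union of $r$ copies of $H$. For a set $\Sigma$, $\Sigma^{<\omega}$ is the set of finite strings over $\Sigma$; a subtree is a prefix-closed subset, and a leaf is an element with no proper extension in the subtree. An adaptive left query algorithm over $\mathbb{N}$ is a function $G:\mathcal{T}\to\mathsf{FIN}\cup\{\mathsf{YES},\mathsf{NO}\}$, where $\mathcal{T}\subseteq\mathbb{N}^{<\omega}$ is a subtree and $G(\sigma)\in\{\mathsf{YES},\mathsf{NO}\}$ iff $\sigma$ is a leaf. Its computation path on $A$ is the limit of $\sigma_0=\varepsilon$, $\sigma_{i+1}=\sigma_i$ if $G(\sigma_i)\in\{\mathsf{YES},\mathsf{NO}\}$ and $\sigma_{i+1}=\sigma_i\bullet\hom(G(\sigma_i),A)$ otherwise; the algorithm must halt (finite path) on every input, and it accepts $A$ iff $G$ of the final path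 is $\mathsf{YES}$. It is an adaptive left $k$-query algorithm if every computation path has length at most $k$. An algorithm separates classes $\mathcal{A},\mathcal{B}$ if it accepts all of $\mathcal{A}$ and rejects all of $\mathcal{B}$, or vice versa. -}

module Defs where

open import Data.Nat using (ℕ; zero; suc; _+_; _*_; _∸_; _^_; _≤_; _≡ᵇ_)
open import Data.Bool using (Bool; true; false; _∧_; _∨_; not; if_then_else_)
open import Data.Fin using (Fin; toℕ; splitAt)
import Data.Fin as Fin
open import Data.List using (List; []; _∷_; _∷ʳ_; _++_; map; concatMap; allFin; length; filter)
open import Data.Bool.ListAction using (and)
open import Data.Sum using (_⊎_; inj₁; inj₂)
open import Data.Product using (Σ; ∃; ∃-syntax; _×_; _,_)
open import Data.Empty using (⊥)
open import Relation.Binary.PropositionalEquality using (_≡_)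
open import Relation.Nullary using (¬_)
open import Data.Nat.Base using (NonZero)
open import Data.Nat.Properties using (m^n≢0)
open import Data.Unit using (⊤)
open import Data.Bool.Properties using (T?)

-- Digraphs: finite structures (V, R), V nonempty.
-- V = Fin (suc pred) (so V ≠ ∅), R given as a Boolean relation.

record Digraph : Set where
  constructor digraph
  field
    pred : ℕ
    edge : Fin (suc pred) → Fin (suc pred) → Bool

open Digraph public

V : Digraph → Set
V D = Fin (suc (pred D))

cons : ∀ {a b} → Fin b → (Fin a → Fin b) → Fin (suc a) → Fin b
cons x f Fin.zero    = x
cons x f (Fin.suc i) = f i

allFuns : (a b : ℕ) → List (Fin a → Fin b)
allFuns zero    b = (λ ()) ∷ []
allFuns (suc a) b = concatMap (λ x → map (cons x) (allFuns a b)) (allFin b)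

isHomᵇ : (F D : Digraph) → (V F → V D) → Bool
isHomᵇ F D f =
  and (concatMap (λ i → map (λ j → not (edge F i j) ∨ edge D (f i) (f j))
                             (allFin (suc (pred F))))
                 (allFin (suc (pred F))))

hom : Digraph → Digraph → ℕ
hom F D = length (filter (λ f → T? (isHomᵇ F D f)) (allFuns (suc (pred F)) (suc (pred D))))

cycle : (p : ℕ) → .{{NonZero p}} → Digraph
cycle (suc q) = digraph q (λ i j → (toℕ j ≡ᵇ suc (toℕ i)) ∨ ((toℕ i ≡ᵇ q) ∧ (toℕ j ≡ᵇ 0)))

_⊕_ : Digraph → Digraph → Digraph
F ⊕ D = digraph (pred F + suc (pred D)) R
  where
  R : Fin (suc (pred F) + suc (pred D)) → Fin (suc (pred F) + suc (pred D)) → Bool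
  R x y with splitAt (suc (pred F)) x | splitAt (suc (pred F)) y
  ... | inj₁ i | inj₁ j = edge F i j
  ... | inj₂ i | inj₂ j = edge D i j
  ... | _      | _      = false

_·_ : (r : ℕ) → .{{NonZero r}} → Digraph → Digraph
(suc zero) · H = H
(suc (suc r)) · H = H ⊕ ((suc r) · H)

block : ℕ → ℕ → Digraph
block n m = _·_ (2 ^ (n ∸ m)) {{m^n≢0 2 (n ∸ m)}} (cycle (2 ^ m) {{m^n≢0 2 m}})

Even Odd : ℕ → Set
Even m = ∃[ j ] (m ≡ 2 * j)
Odd m = ∃[ j ] (m ≡ suc (2 * j))

𝒟 : ℕ → Digraph → Set
𝒟 n A = ∃[ m ] (m ≤ n × Even m × A ≡ block n m)

𝒟′ : ℕ → Digraph → Set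
𝒟′ n A = ∃[ m ] (m ≤ n × Odd m × A ≡ block n m)

data Out : Set where
  query : Digraph → Out
  YES NO : Out

IsVerdict : Out → Set
IsVerdict (query _) = ⊥
IsVerdict YES = ⊤
IsVerdict NO = ⊤

isVerdictᵇ : Out → Bool
isVerdictᵇ (query _) = false
isVerdictᵇ YES = true
isVerdictᵇ NO = true

-- Strings over ℕ are lists; σ • x is σ ∷ʳ x.
-- G is given on all strings, but only its values on the subtree 𝒯 matter.
record Algorithm : Set₁ where
  field
    𝒯 : List ℕ → Set
    prefix-closed : ∀ σ τ → 𝒯 (σ ++ τ) → 𝒯 σ
    G : List ℕ → Out
    leaf-iff : ∀ σ → 𝒯 σ →
      (IsVerdict (G σ) → ∀ τ → 𝒯 (σ ++ τ) → τ ≡ [])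
      × ((∀ τ → 𝒯 (σ ++ τ) → τ ≡ []) → IsVerdict (G σ))

  step : Digraph → List ℕ → List ℕ
  step A σ with G σ
  ... | query F = σ ∷ʳ hom F A
  ... | YES = σ
  ... | NO = σ

  path : Digraph → ℕ → List ℕ
  path A zero = []
  path A (suc i) = step A (path A i)

  HaltsWithin : ℕ → Digraph → Set
  HaltsWithin k A = ∃[ i ] (i ≤ k × 𝒯 (path A i) × IsVerdict (G (path A i)))

  Accepts : Digraph → Set
  Accepts A = ∃[ i ] (𝒯 (path A i) × G (path A i) ≡ YES)

  Rejects : Digraph → Set
  Rejects A = ∃[ i ] (𝒯 (path A i) × G (path A i) ≡ NO)

open Algorithm public

IsKQuery : ℕ → Algorithm → Set
IsKQuery k Alg = ∀ A → HaltsWithin Alg k A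

Separates : Algorithm → (Digraph → Set) → (Digraph → Set) → Set
Separates Alg 𝒜 ℬ =
  ((∀ A → 𝒜 A → Accepts Alg A) × (∀ B → ℬ B → Rejects Alg B))
  ⊎ ((∀ A → 𝒜 A → Rejects Alg A) × (∀ B → ℬ B → Accepts Alg B))

KSeparable : ℕ → (Digraph → Set) → (Digraph → Set) → Set₁
KSeparable k 𝒜 ℬ = Σ Algorithm (λ Alg → IsKQuery k Alg × Separates Alg 𝒜 ℬ)

{-# OPTIONS --safe #-}
module Submission where

-- For every digraph F, the left query F sees the blocks D(n, m) = 2^(n-m) · C_(2^m) (block n m)
-- only through a threshold: m ↦ hom(F, D(n, m)) vanishes above some m₀ and is constant on [0, m₀].
-- Indeed D(n, m) is a union of 2^m-cycles on 2^n vertices; given ℓ : F → C_(2^m), moving the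
-- image of each vertex i forward ℓ(i) steps along its cycle is a bijection from the maps
-- V F → Fin 2^n that are constant along edges onto the homomorphisms F → D(n, m), and a
-- homomorphism F → D(n, m') yields one into C_(2^m) for every m ≤ m'.  The cycle queries
-- C_(2^j) realise every threshold, so binary search finds m, hence its parity, with
-- ⌈log₂(n+1)⌉ queries.  Conversely, answering each query so as to keep the larger threshold
-- class, an adversary retains ⌈(n+1)/2^i⌉ consecutive candidates after i queries; with fewer
-- than ⌈log₂(n+1)⌉ queries two consecutive m, of different parities, are not told apart.

open import Defs
open import Data.Nat
  using (ℕ; zero; suc; _+_; _*_; _∸_; _^_; _≤_; _<_; _%_; _/_; _≡ᵇ_; NonZero; z≤n; s≤s; s≤s⁻¹; ⌊_/2⌋; ⌈_/2⌉)
import Data.Nat as ℕ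
open import Data.Nat.Properties
open import Data.Nat.DivMod using (m≡m%n+[m/n]*n; [m+kn]%n≡m%n; [m+n]%n≡m%n; m%n<n; m<n⇒m%n≡m; n%n≡0)
open import Data.Nat.Divisibility using (_∣_; divides; ∣⇒≤)
open import Data.Nat.GeneralisedArithmetic using (fold; fold-+)
open import Data.Nat.Logarithm using (⌈log₂_⌉; ⌈log₂⌉-mono-≤; ⌈log₂⌈n/2⌉⌉≡⌈log₂n⌉∸1; ⌈log₂2^n⌉≡n)
open import Data.Bool using (Bool; true; false; T; not; _∨_; _∧_)
open import Data.Bool.Properties using (T?; T-∨; T-∧)
open import Data.Bool.ListAction using (and)
open import Data.Fin using (Fin; toℕ; fromℕ<; splitAt; join; _↑ˡ_; _↑ʳ_)
import Data.Fin as Fin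
open import Data.Fin.Properties
  using (toℕ-fromℕ<; toℕ-injective; toℕ<n; splitAt-↑ˡ; splitAt-↑ʳ; join-splitAt)
open import Data.Fin.Permutation using (Permutation′; permutation; _⟨$⟩ʳ_)
open import Data.List
  using (List; []; _∷_; _∷ʳ_; _++_; [_]; map; concatMap; filter; length; allFin; tabulate; foldl)
open import Data.List.Properties using (filter-++; filter-≐; filter-some; length-++; map-id; foldl-∷ʳ)
open import Data.List.Relation.Unary.Any as Any using (Any; here)
import Data.List.Relation.Unary.Any.Properties as Anyₚ
open import Data.List.Relation.Unary.All as All using (All)
import Data.List.Relation.Unary.All.Properties as Allₚ
open import Data.List.Membership.Propositional using (_∈_)
open import Data.List.Membership.Propositional.Properties using (∈-filter⁻; ∈-allFin)
open import Data.Product using (∃-syntax; _×_; _,_; proj₁; proj₂)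
open import Data.Sum using (_⊎_; inj₁; inj₂; [_,_]′)
open import Data.Unit using (⊤; tt)
open import Data.Empty using (⊥; ⊥-elim)
open import Function using (_∘_; id; _⇔_; Equivalence; mk⇔; Injection)
open import Function.Properties.Inverse using (↔⇒↣)
open import Relation.Nullary using (¬_; Dec; yes; no)
open import Relation.Nullary.Decidable using (isYes; toWitness; fromWitness)
open import Relation.Binary.PropositionalEquality hiding ([_])
open import Algebra.Properties.CommutativeMonoid.Sum +-0-commutativeMonoid
  using (sum; sum-permute; sum-cong-≗)

private variable
  A B : Set
  a b : ℕ

count : (A → Bool) → List A → ℕ
count P xs = length (filter (T? ∘ P) xs)

count-++ : (P : A → Bool) (xs ys : List A) → count P (xs ++ ys) ≡ count P xs + count P ys
count-++ P xs ys = trans (cong length (filter-++ (T? ∘ P) xs ys)) (length-++ (filter (T? ∘ P) xs))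

count-map : (P : B → Bool) (f : A → B) (xs : List A) → count P (map f xs) ≡ count (P ∘ f) xs
count-map P f []       = refl
count-map P f (x ∷ xs) with P (f x)
... | true  = cong suc (count-map P f xs)
... | false = count-map P f xs

count-cong : {P Q : A → Bool} → (∀ x → T (P x) ⇔ T (Q x)) → (xs : List A) → count P xs ≡ count Q xs
count-cong {P = P} {Q} P⇔Q xs = cong length
  (filter-≐ (T? ∘ P) (T? ∘ Q) ((λ {x} → Equivalence.to (P⇔Q x)) , λ {x} → Equivalence.from (P⇔Q x)) xs)

count-concatMap-tabulate : (P : B → Bool) (g : A → List B) (f : Fin a → A) →
  count P (concatMap g (tabulate f)) ≡ sum (λ i → count P (g (f i)))
count-concatMap-tabulate {a = zero}  P g f = refl
count-concatMap-tabulate {a = suc a} P g f = trans (count-++ P (g (f Fin.zero)) _)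
  (cong (count P (g (f Fin.zero)) +_) (count-concatMap-tabulate P g (f ∘ Fin.suc)))

count-pos⁺ : {P : A → Bool} {xs : List A} → Any (T ∘ P) xs → 0 < count P xs
count-pos⁺ {P = P} = filter-some (T? ∘ P)

count-pos⁻ : (P : A → Bool) (xs : List A) → 0 < count P xs → ∃[ x ] T (P x)
count-pos⁻ P xs pos with filter (T? ∘ P) xs in eq
... | y ∷ _ = y , proj₂ (∈-filter⁻ (T? ∘ P) {xs = xs} (subst (y ∈_) (sym eq) (here refl)))

countMaps : (a b : ℕ) → ((Fin a → Fin b) → Bool) → ℕ
countMaps a b P = count P (allFuns a b)

Extensional : ((Fin a → Fin b) → Bool) → Set
Extensional P = ∀ {f g} → f ≗ g → T (P f) → T (P g)

cons-≗ : ∀ {x : Fin b} {g : Fin a → Fin b} {f} → x ≡ f Fin.zero → g ≗ f ∘ Fin.suc → cons x g ≗ f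
cons-≗ x≡f₀ g≗f₊ Fin.zero    = x≡f₀
cons-≗ x≡f₀ g≗f₊ (Fin.suc i) = g≗f₊ i

∈-allFuns : (f : Fin a → Fin b) → Any (_≗ f) (allFuns a b)
∈-allFuns {a = zero}  f = here (λ ())
∈-allFuns {a = suc a} f = Anyₚ.concat⁺ (Anyₚ.map⁺ (Any.map
  (λ { refl → Anyₚ.map⁺ (Any.map (cons-≗ refl) (∈-allFuns (f ∘ Fin.suc))) })
  (∈-allFin (f Fin.zero))))

countMaps-pos⁺ : {P : (Fin a → Fin b) → Bool} → Extensional P →
  (f : Fin a → Fin b) → T (P f) → 0 < countMaps a b P
countMaps-pos⁺ P-ext f Pf = count-pos⁺ (Any.map (λ g≗f → P-ext (sym ∘ g≗f) Pf) (∈-allFuns f))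

countMaps-suc : (P : (Fin (suc a) → Fin b) → Bool) →
  countMaps (suc a) b P ≡ sum (λ x → countMaps a b (P ∘ cons x))
countMaps-suc {a} {b} P = begin
  count P (concatMap (λ x → map (cons x) (allFuns a b)) (allFin b))
    ≡⟨ count-concatMap-tabulate P (λ x → map (cons x) (allFuns a b)) id ⟩
  sum (λ x → count P (map (cons x) (allFuns a b)))
    ≡⟨ sum-cong-≗ (λ x → count-map P (cons x) (allFuns a b)) ⟩
  sum (λ x → countMaps a b (P ∘ cons x))
    ∎
  where open ≡-Reasoning

countMaps-permute : (π : Fin a → Permutation′ b) {P : (Fin a → Fin b) → Bool} → Extensional P →
  countMaps a b P ≡ countMaps a b (λ g → P (λ i → π i ⟨$⟩ʳ g i))
countMaps-permute {a = zero} π P-ext = count-cong (λ g → mk⇔ (P-ext (λ ())) (P-ext (λ ()))) (allFuns 0 _)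
countMaps-permute {a = suc a} {b} π {P} P-ext = begin
  countMaps (suc a) b P
    ≡⟨ countMaps-suc P ⟩
  sum (λ x → countMaps a b (P ∘ cons x))
    ≡⟨ sum-permute _ (π Fin.zero) ⟩
  sum (λ y → countMaps a b (P ∘ cons (π₀ y)))
    ≡⟨ sum-cong-≗ (λ y → countMaps-permute (π ∘ Fin.suc) {P ∘ cons (π₀ y)} (P-ext ∘ cons-≗ refl)) ⟩
  sum (λ y → countMaps a b (λ g → P (cons (π₀ y) (λ i → π (Fin.suc i) ⟨$⟩ʳ g i))))
    ≡⟨ sum-cong-≗ (λ y → count-cong (reassemble y) (allFuns a b)) ⟩
  sum (λ y → countMaps a b (P′ ∘ cons y))
    ≡⟨ countMaps-suc P′ ⟨
  countMaps (suc a) b P′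
    ∎
  where
  open ≡-Reasoning
  π₀ = π Fin.zero ⟨$⟩ʳ_
  P′ : (Fin (suc a) → Fin b) → Bool
  P′ g = P (λ i → π i ⟨$⟩ʳ g i)
  reassemble : ∀ y g → T (P (cons (π₀ y) (λ i → π (Fin.suc i) ⟨$⟩ʳ g i))) ⇔ T (P′ (cons y g))
  reassemble y g = mk⇔ (P-ext (cons-≗ refl (λ _ → refl))) (P-ext (sym ∘ cons-≗ refl (λ _ → refl)))

order : Digraph → ℕ
order D = suc (pred D)

IsHom : (F D : Digraph) → (V F → V D) → Set
IsHom F D f = ∀ {i j} → T (edge F i j) → T (edge D (f i) (f j))

record Hom (F D : Digraph) : Set where
  constructor mkHom
  field
    fun       : V F → V D
    preserves : IsHom F D fun

idʰ : ∀ {D} → Hom D D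
idʰ = mkHom id id

_∘ʰ_ : ∀ {F D E} → Hom D E → Hom F D → Hom F E
mkHom g g-hom ∘ʰ mkHom f f-hom = mkHom (g ∘ f) (g-hom ∘ f-hom)

allEdgesᵇ : (F : Digraph) → (V F → V F → Bool) → Bool
allEdgesᵇ F R =
  and (concatMap (λ i → map (λ j → not (edge F i j) ∨ R i j) (allFin (order F))) (allFin (order F)))

T-and⇔All : ∀ bs → T (and bs) ⇔ All T bs
T-and⇔All bs = mk⇔
  (Allₚ.all⁺ id bs ∘ subst (T ∘ and) (sym (map-id bs)))
  (subst (T ∘ and) (map-id bs) ∘ Allₚ.all⁻ id)

T-implication : ∀ {x y} → T (not x ∨ y) ⇔ (T x → T y)
T-implication {true}  = mk⇔ (λ y _ → y) (λ x⇒y → x⇒y _)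
T-implication {false} = mk⇔ (λ _ ()) _

T-allEdgesᵇ : ∀ F R → T (allEdgesᵇ F R) ⇔ (∀ {i j} → T (edge F i j) → T (R i j))
T-allEdgesᵇ F R = mk⇔ to from
  where
  vertices = allFin (order F)
  row : V F → List Bool
  row i = map (λ j → not (edge F i j) ∨ R i j) vertices
  to : T (allEdgesᵇ F R) → ∀ {i j} → T (edge F i j) → T (R i j)
  to all-true {i} {j} = Equivalence.to T-implication (All.lookup (Allₚ.map⁻ (All.lookup (Allₚ.map⁻
    (Allₚ.concat⁻ {xss = map row vertices} (Equivalence.to (T-and⇔All _) all-true))) (∈-allFin i))) (∈-allFin j))
  from : (∀ {i j} → T (edge F i j) → T (R i j)) → T (allEdgesᵇ F R)
  from R-on-edges = Equivalence.from (T-and⇔All _) (Allₚ.concat⁺ (Allₚ.map⁺ {xs = vertices} {f = row}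
    (All.tabulate λ {i} _ → Allₚ.map⁺ {xs = vertices}
      (All.tabulate λ {j} _ → Equivalence.from T-implication (R-on-edges {i} {j})))))

allEdgesᵇ-cong : ∀ F R R′ → (∀ {i j} → T (edge F i j) → T (R i j) ⇔ T (R′ i j)) →
  T (allEdgesᵇ F R) ⇔ T (allEdgesᵇ F R′)
allEdgesᵇ-cong F R R′ R⇔R′ = mk⇔
  (λ t → from (T-allEdgesᵇ F R′) (λ e → to (R⇔R′ e) (to (T-allEdgesᵇ F R) t e)))
  (λ t → from (T-allEdgesᵇ F R) (λ e → from (R⇔R′ e) (to (T-allEdgesᵇ F R′) t e)))
  where open Equivalence

isHomᵇ⇔IsHom : ∀ F D f → T (isHomᵇ F D f) ⇔ IsHom F D f
isHomᵇ⇔IsHom F D f = T-allEdgesᵇ F (λ i j → edge D (f i) (f j))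

isHomᵇ-extensional : ∀ F D → Extensional (isHomᵇ F D)
isHomᵇ-extensional F D {f} {g} f≗g f-hom = Equivalence.from (isHomᵇ⇔IsHom F D g)
  (subst₂ (λ x y → T (edge D x y)) (f≗g _) (f≗g _) ∘ Equivalence.to (isHomᵇ⇔IsHom F D f) f-hom)

hom-pos⁺ : ∀ {F D} → Hom F D → 0 < hom F D
hom-pos⁺ {F} {D} (mkHom f f-hom) =
  countMaps-pos⁺ (isHomᵇ-extensional F D) f (Equivalence.from (isHomᵇ⇔IsHom F D f) f-hom)

hom-pos⁻ : ∀ {F D} → 0 < hom F D → Hom F D
hom-pos⁻ {F} {D} pos with f , f-hom ← count-pos⁻ (isHomᵇ F D) (allFuns (order F) (order D)) pos =
  mkHom f (Equivalence.to (isHomᵇ⇔IsHom F D f) f-hom)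

edgeConstantᵇ : (F : Digraph) → (V F → Fin b) → Bool
edgeConstantᵇ F g = allEdgesᵇ F (λ i j → isYes (g i Fin.≟ g j))

_HasPeriod_ : (A → A) → ℕ → Set
f HasPeriod q = ∀ x → fold x f q ≡ x

fold-commute : {f : A → A} {f′ : B → B} (g : A → B) → (∀ x → g (f x) ≡ f′ (g x)) →
  ∀ x t → g (fold x f t) ≡ fold (g x) f′ t
fold-commute           g g∘f≗f′∘g x zero    = refl
fold-commute {f′ = f′} g g∘f≗f′∘g x (suc t) = trans (g∘f≗f′∘g _) (cong f′ (fold-commute g g∘f≗f′∘g x t))

HasPeriod-∣ : ∀ {f : A → A} {q p} → f HasPeriod q → q ∣ p → f HasPeriod p
HasPeriod-∣ {f = f} {q} period (divides k refl) = multiple k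
  where
  multiple : ∀ k → f HasPeriod (k * q)
  multiple zero    x = refl
  multiple (suc k) x = trans (fold-+ x f q) (trans (cong (λ y → fold y f q) (multiple k x)) (period x))

fold-% : ∀ {f : A → A} {q} .{{_ : NonZero q}} → f HasPeriod q → ∀ x t → fold x f (t % q) ≡ fold x f t
fold-% {f = f} {q} period x t = begin
  fold x f (t % q)
    ≡⟨ cong (λ y → fold y f (t % q)) (HasPeriod-∣ period (divides (t / q) refl) x) ⟨
  fold (fold x f (t / q * q)) f (t % q)
    ≡⟨ fold-+ x f (t % q) ⟨
  fold x f (t % q + t / q * q)
    ≡⟨ cong (fold x f) (m≡m%n+[m/n]*n t q) ⟨
  fold x f t
    ∎
  where open ≡-Reasoning

-- The functional graph of a map succ of period q: a disjoint union of cycles whose lengths divide q.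
record Periodic (q : ℕ) (D : Digraph) : Set where
  field
    succ      : V D → V D
    edge⇒succ : ∀ {a b} → T (edge D a b) → b ≡ succ a
    edge-succ : ∀ a → T (edge D a (succ a))
    period    : succ HasPeriod q

module _ {q D} .{{_ : NonZero q}} (P : Periodic q D) where
  open Periodic P

  succ^ : ℕ → Permutation′ (order D)
  succ^ t = permutation (λ a → fold a succ t) (λ a → fold a succ (t * ℕ.pred q)) cancel cancel′
    where
    full-turns : ∀ a → fold a succ (t + t * ℕ.pred q) ≡ a
    full-turns a = trans
      (cong (fold a succ) (trans (sym (*-suc t (ℕ.pred q))) (trans (cong (t *_) (suc-pred q)) (*-comm t q))))
      (HasPeriod-∣ period (divides t (*-comm q t)) a)
    cancel : ∀ a → fold (fold a succ (t * ℕ.pred q)) succ t ≡ a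
    cancel a = trans (sym (fold-+ a succ t)) (full-turns a)
    cancel′ : ∀ a → fold (fold a succ t) succ (t * ℕ.pred q) ≡ a
    cancel′ a = trans (sym (fold-+ a succ (t * ℕ.pred q)))
      (trans (cong (fold a succ) (+-comm (t * ℕ.pred q) t)) (full-turns a))

  succ^-injective : ∀ t {a b} → fold a succ t ≡ fold b succ t → a ≡ b
  succ^-injective t = Injection.injective (↔⇒↣ (succ^ t))

hom-preserves-succ : ∀ {q q′ D E} (P : Periodic q D) (P′ : Periodic q′ E) (f : Hom D E) →
  ∀ a → Hom.fun f (Periodic.succ P a) ≡ Periodic.succ P′ (Hom.fun f a)
hom-preserves-succ P P′ (mkHom f f-hom) a = Periodic.edge⇒succ P′ (f-hom (Periodic.edge-succ P a))

sucMod : ∀ {q} .{{_ : NonZero q}} → Fin q → Fin q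
sucMod {q} i = fromℕ< (m%n<n (suc (toℕ i)) q)

toℕ-sucMod : ∀ {q} .{{_ : NonZero q}} (i : Fin q) → toℕ (sucMod i) ≡ suc (toℕ i) % q
toℕ-sucMod {q} i = toℕ-fromℕ< (m%n<n (suc (toℕ i)) q)

sucMod-cases : ∀ {p} (i : Fin (suc p)) →
  (toℕ i < p × toℕ (sucMod i) ≡ suc (toℕ i)) ⊎ (toℕ i ≡ p × toℕ (sucMod i) ≡ 0)
sucMod-cases {p} i with m≤n⇒m<n∨m≡n (s≤s⁻¹ (toℕ<n i))
... | inj₁ i<p = inj₁ (i<p , trans (toℕ-sucMod i) (m<n⇒m%n≡m (s≤s i<p)))
... | inj₂ i≡p = inj₂ (i≡p , trans (toℕ-sucMod i) (trans (cong (λ x → suc x % suc p) i≡p) (n%n≡0 (suc p))))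

suc-% : ∀ x q .{{_ : NonZero q}} → suc (x % q) % q ≡ suc x % q
suc-% x q = begin
  suc (x % q) % q                ≡⟨ [m+kn]%n≡m%n (suc (x % q)) (x / q) q ⟨
  suc (x % q + (x / q) * q) % q  ≡⟨ cong (λ y → suc y % q) (m≡m%n+[m/n]*n x q) ⟨
  suc x % q                      ∎
  where open ≡-Reasoning

toℕ-fold-sucMod : ∀ {q} .{{_ : NonZero q}} (i : Fin q) t → toℕ (fold i sucMod t) ≡ (toℕ i + t) % q
toℕ-fold-sucMod {q} i zero    = sym (trans (cong (_% q) (+-identityʳ (toℕ i))) (m<n⇒m%n≡m (toℕ<n i)))
toℕ-fold-sucMod {q} i (suc t) = begin
  toℕ (sucMod (fold i sucMod t))   ≡⟨ toℕ-sucMod _ ⟩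
  suc (toℕ (fold i sucMod t)) % q  ≡⟨ cong (λ x → suc x % q) (toℕ-fold-sucMod i t) ⟩
  suc ((toℕ i + t) % q) % q        ≡⟨ suc-% (toℕ i + t) q ⟩
  suc (toℕ i + t) % q              ≡⟨ cong (_% q) (+-suc (toℕ i) t) ⟨
  (toℕ i + suc t) % q              ∎
  where open ≡-Reasoning

fold-sucMod : ∀ {f : A → A} {q} .{{_ : NonZero q}} → f HasPeriod q → ∀ x (i : Fin q) →
  fold x f (toℕ (sucMod i)) ≡ f (fold x f (toℕ i))
fold-sucMod {f = f} period x i = trans (cong (fold x f) (toℕ-sucMod i)) (fold-% period x (suc (toℕ i)))

cycle-periodic : ∀ q .{{_ : NonZero q}} → Periodic q (cycle q)
cycle-periodic (suc p) = record
  { succ      = sucMod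
  ; edge⇒succ = λ {i} {j} e → toℕ-injective (edge⇒toℕ-succ i j (Equivalence.to T-∨ e))
  ; edge-succ = edge-succ
  ; period    = λ i → toℕ-injective (trans (toℕ-fold-sucMod i (suc p))
                  (trans ([m+n]%n≡m%n (toℕ i) (suc p)) (m<n⇒m%n≡m (toℕ<n i))))
  }
  where
  edge⇒toℕ-succ : ∀ i j → T (toℕ j ≡ᵇ suc (toℕ i)) ⊎ T ((toℕ i ≡ᵇ p) ∧ (toℕ j ≡ᵇ 0)) →
    toℕ j ≡ toℕ (sucMod i)
  edge⇒toℕ-succ i j e with sucMod-cases i | e
  ... | inj₁ (_ , succ-i) | inj₁ j-next = trans (≡ᵇ⇒≡ _ _ j-next) (sym succ-i)
  ... | inj₂ (_ , succ-i) | inj₂ wrap   = trans (≡ᵇ⇒≡ _ _ (proj₂ (Equivalence.to T-∧ wrap))) (sym succ-i)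
  ... | inj₂ (i≡p , _)    | inj₁ j-next =
    ⊥-elim (<-irrefl (cong suc i≡p) (subst (_< suc p) (≡ᵇ⇒≡ _ _ j-next) (toℕ<n j)))
  ... | inj₁ (i<p , _)    | inj₂ wrap   = ⊥-elim (<-irrefl (≡ᵇ⇒≡ _ _ (proj₁ (Equivalence.to T-∧ wrap))) i<p)
  edge-succ : ∀ i → T (edge (cycle (suc p)) i (sucMod i))
  edge-succ i with sucMod-cases i
  ... | inj₁ (_ , succ-i)   = Equivalence.from T-∨ (inj₁ (≡⇒≡ᵇ _ _ succ-i))
  ... | inj₂ (i≡p , succ-i) = Equivalence.from T-∨ (inj₂ (Equivalence.from T-∧ (≡⇒≡ᵇ _ _ i≡p , ≡⇒≡ᵇ _ _ succ-i)))

order-cycle : ∀ q .{{_ : NonZero q}} → order (cycle q) ≡ q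
order-cycle (suc q) = refl

∣⇒cycle-hom : ∀ {p q D} .{{_ : NonZero p}} → Periodic q D → q ∣ p → V D → Hom (cycle p) D
∣⇒cycle-hom {p@(suc _)} {D = D} P q∣p v = mkHom wind λ {i} {j} e →
  subst (λ j → T (edge D (wind i) (wind j))) (sym (Periodic.edge⇒succ (cycle-periodic p) {i} {j} e))
    (subst (T ∘ edge D (wind i)) (sym (fold-sucMod (HasPeriod-∣ period q∣p) v i)) (edge-succ (wind i)))
  where
  open Periodic P
  wind : Fin p → V D
  wind i = fold v succ (toℕ i)

%-fixed⇒∣ : ∀ x p q .{{_ : NonZero q}} → (x + p) % q ≡ x → q ∣ p
%-fixed⇒∣ x p q fixed = divides ((x + p) / q) (+-cancelˡ-≡ x p _ (begin
  x + p                          ≡⟨ m≡m%n+[m/n]*n (x + p) q ⟩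
  (x + p) % q + (x + p) / q * q  ≡⟨ cong (_+ (x + p) / q * q) fixed ⟩
  x + (x + p) / q * q            ∎))
  where open ≡-Reasoning

cycle-hom⇒∣ : ∀ {p q} .{{_ : NonZero p}} .{{_ : NonZero q}} → Hom (cycle p) (cycle q) → q ∣ p
cycle-hom⇒∣ {p@(suc _)} {q@(suc _)} f =
  %-fixed⇒∣ (toℕ (f.fun Fin.zero)) p q (sym (trans (cong toℕ f₀-fixed) (toℕ-fold-sucMod _ p)))
  where
  module f = Hom f
  f₀-fixed : f.fun Fin.zero ≡ fold (f.fun Fin.zero) sucMod p
  f₀-fixed = trans (cong f.fun (sym (Periodic.period (cycle-periodic p) Fin.zero)))
    (fold-commute {f′ = sucMod} f.fun (hom-preserves-succ (cycle-periodic p) (cycle-periodic q) f) Fin.zero p)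

-- Shifting g i by ℓ i steps along the cycles of D turns edge-constant maps into homomorphisms.
hom-periodic≡edgeConstant : ∀ {q D F} .{{_ : NonZero q}} → Periodic q D → Hom F (cycle q) →
  hom F D ≡ countMaps (order F) (order D) (edgeConstantᵇ F)
hom-periodic≡edgeConstant {q@(suc _)} {D} {F} P (mkHom ℓ ℓ-hom) = begin
  hom F D
    ≡⟨ countMaps-permute π (isHomᵇ-extensional F D) ⟩
  countMaps (order F) (order D) (λ g → isHomᵇ F D (λ i → π i ⟨$⟩ʳ g i))
    ≡⟨ count-cong (λ g → allEdgesᵇ-cong F _ (λ i j → isYes (g i Fin.≟ g j)) (shifted-edge g))
                  (allFuns (order F) (order D)) ⟩
  countMaps (order F) (order D) (edgeConstantᵇ F)
    ∎
  where
  open ≡-Reasoning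
  open Periodic P
  π : V F → Permutation′ (order D)
  π i = succ^ P (toℕ (ℓ i))
  shifted-edge : ∀ (g : V F → V D) {i j} → T (edge F i j) →
    T (edge D (π i ⟨$⟩ʳ g i) (π j ⟨$⟩ʳ g j)) ⇔ T (isYes (g i Fin.≟ g j))
  shifted-edge g {i} {j} e = mk⇔
    (λ e′ → fromWitness {a? = g i Fin.≟ g j} (sym (succ^-injective P (toℕ (ℓ i))
      (succ^-injective P 1 (trans (sym (shift (g j))) (edge⇒succ e′))))))
    (λ gᵢ≡gⱼ → subst (T ∘ edge D (φ (g i))) (sym (shift (g j)))
      (subst (λ z → T (edge D (φ (g i)) (succ (φ z)))) (toWitness {a? = g i Fin.≟ g j} gᵢ≡gⱼ)
        (edge-succ (φ (g i)))))
    where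
    φ : V D → V D
    φ x = π i ⟨$⟩ʳ x
    shift : ∀ x → π j ⟨$⟩ʳ x ≡ succ (φ x)
    shift x = trans
      (cong (λ k → fold x succ (toℕ k)) (Periodic.edge⇒succ (cycle-periodic q) {ℓ i} {ℓ j} (ℓ-hom e)))
      (fold-sucMod period x (ℓ i))

module _ {H D : Digraph} where

  inl : V H → V (H ⊕ D)
  inl a = a ↑ˡ order D

  inr : V D → V (H ⊕ D)
  inr b = order H ↑ʳ b

  data Side : V (H ⊕ D) → Set where
    left  : ∀ a → Side (inl a)
    right : ∀ b → Side (inr b)

  side : ∀ x → Side x
  side x = subst Side (join-splitAt (order H) (order D) x) (from-sum (splitAt (order H) x))
    where
    from-sum : ∀ s → Side (join (order H) (order D) s)
    from-sum (inj₁ a) = left a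
    from-sum (inj₂ b) = right b

  copair : {X : Set} → (V H → X) → (V D → X) → V (H ⊕ D) → X
  copair f g = [ f , g ]′ ∘ splitAt (order H)

  copair-inl : ∀ {X : Set} (f : V H → X) (g : V D → X) a → copair f g (inl a) ≡ f a
  copair-inl f g a = cong [ f , g ]′ (splitAt-↑ˡ (order H) a (order D))

  copair-inr : ∀ {X : Set} (f : V H → X) (g : V D → X) b → copair f g (inr b) ≡ g b
  copair-inr f g b = cong [ f , g ]′ (splitAt-↑ʳ (order H) (order D) b)

  edge-inl-inl : ∀ a a′ → edge (H ⊕ D) (inl a) (inl a′) ≡ edge H a a′
  edge-inl-inl a a′ rewrite splitAt-↑ˡ (order H) a (order D) | splitAt-↑ˡ (order H) a′ (order D) = refl

  edge-inr-inr : ∀ b b′ → edge (H ⊕ D) (inr b) (inr b′) ≡ edge D b b′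
  edge-inr-inr b b′ rewrite splitAt-↑ʳ (order H) (order D) b | splitAt-↑ʳ (order H) (order D) b′ = refl

  edge-inl-inr : ∀ a b → edge (H ⊕ D) (inl a) (inr b) ≡ false
  edge-inl-inr a b rewrite splitAt-↑ˡ (order H) a (order D) | splitAt-↑ʳ (order H) (order D) b = refl

  edge-inr-inl : ∀ b a → edge (H ⊕ D) (inr b) (inl a) ≡ false
  edge-inr-inl b a rewrite splitAt-↑ˡ (order H) a (order D) | splitAt-↑ʳ (order H) (order D) b = refl

  [_,_]ʰ : ∀ {X} → Hom H X → Hom D X → Hom (H ⊕ D) X
  [_,_]ʰ {X} (mkHom f f-hom) (mkHom g g-hom) = mkHom (copair f g) λ {x} {y} → copair-hom {x} {y}
    where
    edge-via : ∀ {u u′ v v′} → u ≡ u′ → v ≡ v′ → T (edge X u′ v′) → T (edge X u v)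
    edge-via refl refl e = e
    copair-hom : IsHom (H ⊕ D) X (copair f g)
    copair-hom {x} {y} e with side x | side y
    ... | left a  | left a′  = edge-via (copair-inl f g a) (copair-inl f g a′) (f-hom (subst T (edge-inl-inl a a′) e))
    ... | right b | right b′ = edge-via (copair-inr f g b) (copair-inr f g b′) (g-hom (subst T (edge-inr-inr b b′) e))
    ... | left a  | right b  = ⊥-elim (subst T (edge-inl-inr a b) e)
    ... | right b | left a   = ⊥-elim (subst T (edge-inr-inl b a) e)

  ⊕-periodic : ∀ {q} → Periodic q H → Periodic q D → Periodic q (H ⊕ D)
  ⊕-periodic {q} PH PD = record
    { succ      = succ
    ; edge⇒succ = λ {x} {y} → edge⇒succ {x} {y}
    ; edge-succ = edge-succ
    ; period    = period
    }
    where
    module PH = Periodic PH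
    module PD = Periodic PD
    succ : V (H ⊕ D) → V (H ⊕ D)
    succ = copair (inl ∘ PH.succ) (inr ∘ PD.succ)
    succ-inl : ∀ a → succ (inl a) ≡ inl (PH.succ a)
    succ-inl = copair-inl (inl ∘ PH.succ) (inr ∘ PD.succ)
    succ-inr : ∀ b → succ (inr b) ≡ inr (PD.succ b)
    succ-inr = copair-inr (inl ∘ PH.succ) (inr ∘ PD.succ)
    edge⇒succ : ∀ {x y} → T (edge (H ⊕ D) x y) → y ≡ succ x
    edge⇒succ {x} {y} e with side x | side y
    ... | left a  | left a′  = trans (cong inl (PH.edge⇒succ (subst T (edge-inl-inl a a′) e))) (sym (succ-inl a))
    ... | right b | right b′ = trans (cong inr (PD.edge⇒succ (subst T (edge-inr-inr b b′) e))) (sym (succ-inr b))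
    ... | left a  | right b  = ⊥-elim (subst T (edge-inl-inr a b) e)
    ... | right b | left a   = ⊥-elim (subst T (edge-inr-inl b a) e)
    edge-succ : ∀ x → T (edge (H ⊕ D) x (succ x))
    edge-succ x with side x
    ... | left a  = subst (T ∘ edge (H ⊕ D) (inl a)) (sym (succ-inl a))
                      (subst T (sym (edge-inl-inl a _)) (PH.edge-succ a))
    ... | right b = subst (T ∘ edge (H ⊕ D) (inr b)) (sym (succ-inr b))
                      (subst T (sym (edge-inr-inr b _)) (PD.edge-succ b))
    period : succ HasPeriod q
    period x with side x
    ... | left a  = trans (sym (fold-commute inl (sym ∘ succ-inl) a q)) (cong inl (PH.period a))
    ... | right b = trans (sym (fold-commute inr (sym ∘ succ-inr) b q)) (cong inr (PD.period b))

·-periodic : ∀ {q H} r .{{_ : NonZero r}} → Periodic q H → Periodic q (r · H)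
·-periodic (suc zero)    P = P
·-periodic (suc (suc r)) P = ⊕-periodic P (·-periodic (suc r) P)

·-elim : ∀ {H X} r .{{_ : NonZero r}} → Hom H X → Hom (r · H) X
·-elim         (suc zero)    f = f
·-elim {X = X} (suc (suc r)) f = [_,_]ʰ {X = X} f (·-elim {X = X} (suc r) f)

order-· : ∀ H r .{{_ : NonZero r}} → order (r · H) ≡ r * order H
order-· H (suc zero)    = sym (*-identityˡ (order H))
order-· H (suc (suc r)) = cong (order H +_) (order-· H (suc r))

dyadicCycle : ℕ → Digraph
dyadicCycle m = cycle (2 ^ m) {{m^n≢0 2 m}}

dyadicCycle-periodic : ∀ m → Periodic (2 ^ m) (dyadicCycle m)
dyadicCycle-periodic m = cycle-periodic (2 ^ m) {{m^n≢0 2 m}}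

block-periodic : ∀ n m → Periodic (2 ^ m) (block n m)
block-periodic n m = ·-periodic (2 ^ (n ∸ m)) {{m^n≢0 2 (n ∸ m)}} (dyadicCycle-periodic m)

block⇒dyadicCycle : ∀ n m → Hom (block n m) (dyadicCycle m)
block⇒dyadicCycle n m = ·-elim {X = dyadicCycle m} (2 ^ (n ∸ m)) {{m^n≢0 2 (n ∸ m)}} idʰ

order-block : ∀ {n m} → m ≤ n → order (block n m) ≡ 2 ^ n
order-block {n} {m} m≤n = begin
  order (block n m)                    ≡⟨ order-· (dyadicCycle m) (2 ^ (n ∸ m)) {{m^n≢0 2 (n ∸ m)}} ⟩
  2 ^ (n ∸ m) * order (dyadicCycle m)  ≡⟨ cong (2 ^ (n ∸ m) *_) (order-cycle (2 ^ m) {{m^n≢0 2 m}}) ⟩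
  2 ^ (n ∸ m) * 2 ^ m                  ≡⟨ ^-distribˡ-+-* 2 (n ∸ m) m ⟨
  2 ^ (n ∸ m + m)                      ≡⟨ cong (2 ^_) (m∸n+n≡m m≤n) ⟩
  2 ^ n                                ∎
  where open ≡-Reasoning

2^∣2^⇔≤ : ∀ {m j} → 2 ^ m ∣ 2 ^ j ⇔ m ≤ j
2^∣2^⇔≤ {m} {j} = mk⇔
  (λ 2^m∣2^j → ≮⇒≥ λ j<m → <⇒≱ (^-monoʳ-< 2 (s≤s (s≤s z≤n)) j<m) (∣⇒≤ {{m^n≢0 2 j}} 2^m∣2^j))
  (λ m≤j → divides (2 ^ (j ∸ m)) (trans (cong (2 ^_) (sym (m∸n+n≡m m≤j))) (^-distribˡ-+-* 2 (j ∸ m) m)))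

0<hom-dyadicCycle-block⇔ : ∀ {j n m} → 0 < hom (dyadicCycle j) (block n m) ⇔ m ≤ j
0<hom-dyadicCycle-block⇔ {j} {n} {m} = mk⇔
  (λ pos → Equivalence.to 2^∣2^⇔≤
    (cycle-hom⇒∣ {{m^n≢0 2 j}} {{m^n≢0 2 m}} (block⇒dyadicCycle n m ∘ʰ hom-pos⁻ pos)))
  (λ m≤j → hom-pos⁺ (∣⇒cycle-hom {{m^n≢0 2 j}} (block-periodic n m) (Equivalence.from 2^∣2^⇔≤ m≤j) Fin.zero))

hom-block≡edgeConstant : ∀ {F n m} → m ≤ n → Hom F (dyadicCycle m) →
  hom F (block n m) ≡ countMaps (order F) (2 ^ n) (edgeConstantᵇ F)
hom-block≡edgeConstant {F} {n} {m} m≤n ℓ =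
  trans (hom-periodic≡edgeConstant {{m^n≢0 2 m}} (block-periodic n m) ℓ)
  (cong (λ b → countMaps (order F) b (edgeConstantᵇ F)) (order-block m≤n))

-- h vanishes above some threshold in [0, n] and is constant below it.
ThresholdFunction : ℕ → (ℕ → ℕ) → Set
ThresholdFunction n h = ∀ {m m′} → m ≤ m′ → m′ ≤ n → 0 < h m′ → h m ≡ h m′

hom-block-threshold : ∀ n F → ThresholdFunction n (λ m → hom F (block n m))
hom-block-threshold n F {m} {m′} m≤m′ m′≤n pos =
  trans (hom-block≡edgeConstant (≤-trans m≤m′ m′≤n) (reduce ∘ʰ ℓ′)) (sym (hom-block≡edgeConstant m′≤n ℓ′))
  where
  ℓ′ : Hom F (dyadicCycle m′)
  ℓ′ = block⇒dyadicCycle n m′ ∘ʰ hom-pos⁻ pos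
  reduce : Hom (dyadicCycle m′) (dyadicCycle m)
  reduce = ∣⇒cycle-hom {{m^n≢0 2 m′}} (dyadicCycle-periodic m) (Equivalence.from 2^∣2^⇔≤ m≤m′) Fin.zero

m+⌊n/2⌋+⌈n/2⌉≡m+n : ∀ m n → m + ⌊ n /2⌋ + ⌈ n /2⌉ ≡ m + n
m+⌊n/2⌋+⌈n/2⌉≡m+n m n = trans (+-assoc m ⌊ n /2⌋ ⌈ n /2⌉) (cong (m +_) (⌊n/2⌋+⌈n/2⌉≡n n))

-- Cut [lo, lo + s) after mid = lo + ⌈s/2⌉ - 1: if h mid > 0 then h is constant on the lower half,
-- otherwise h vanishes on the upper half (both of length ⌈s/2⌉).
threshold-halving : ∀ {n h} → ThresholdFunction n h → ∀ lo s → lo + s ≤ suc n →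
  ∃[ lo′ ] ∃[ v ] (lo ≤ lo′ × lo′ + ⌈ s /2⌉ ≤ lo + s × (∀ {m} → lo′ ≤ m → m < lo′ + ⌈ s /2⌉ → h m ≡ v))
threshold-halving h-thr lo zero fits =
  lo , 0 , ≤-refl , ≤-refl , λ {m} lo≤m m<lo+0 → ⊥-elim (<⇒≱ (subst (m <_) (+-identityʳ lo) m<lo+0) lo≤m)
threshold-halving {n} {h} h-thr lo s@(suc s′) fits with h (lo + ⌊ s′ /2⌋) in h-mid
... | zero   = lo + ⌊ s /2⌋ , 0 , m≤m+n lo _ , ≤-reflexive (m+⌊n/2⌋+⌈n/2⌉≡m+n lo s) , upper
  where
  upper : ∀ {m} → lo + ⌊ s /2⌋ ≤ m → m < lo + ⌊ s /2⌋ + ⌈ s /2⌉ → h m ≡ 0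
  upper {m} upper≤m m<end with h m in h-m
  ... | zero  = refl
  ... | suc _ = ⊥-elim (0≢1+n (trans (sym h-mid) (trans (h-thr mid≤m m≤n (subst (0 <_) (sym h-m) (s≤s z≤n))) h-m)))
    where
    mid≤m = ≤-trans (+-monoʳ-≤ lo (⌊n/2⌋-mono (n≤1+n s′))) upper≤m
    m≤n   = s≤s⁻¹ (≤-trans (subst (m <_) (m+⌊n/2⌋+⌈n/2⌉≡m+n lo s) m<end) fits)
... | suc v′ = lo , suc v′ , ≤-refl , +-monoʳ-≤ lo (⌈n/2⌉≤n s) , lower
  where
  lower : ∀ {m} → lo ≤ m → m < lo + ⌈ s /2⌉ → h m ≡ suc v′
  lower {m} _ m<end = trans (h-thr m≤mid mid≤n (subst (0 <_) (sym h-mid) (s≤s z≤n))) h-mid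
    where
    m≤mid = s≤s⁻¹ (subst (m <_) (+-suc lo _) m<end)
    mid≤n = s≤s⁻¹ (≤-trans (≤-reflexive (sym (+-suc lo ⌊ s′ /2⌋))) (≤-trans (+-monoʳ-≤ lo (⌈n/2⌉≤n s)) fits))

⌈_/2^_⌉ : ℕ → ℕ → ℕ
⌈ x /2^ i ⌉ = fold x ⌈_/2⌉ i

⌈log₂⌈/2^⌉⌉ : ∀ x i → ⌈log₂ ⌈ x /2^ i ⌉ ⌉ ≡ ⌈log₂ x ⌉ ∸ i
⌈log₂⌈/2^⌉⌉ x zero    = refl
⌈log₂⌈/2^⌉⌉ x (suc i) = begin
  ⌈log₂ ⌈ ⌈ x /2^ i ⌉ /2⌉ ⌉  ≡⟨ ⌈log₂⌈n/2⌉⌉≡⌈log₂n⌉∸1 ⌈ x /2^ i ⌉ ⟩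
  ⌈log₂ ⌈ x /2^ i ⌉ ⌉ ∸ 1    ≡⟨ cong (_∸ 1) (⌈log₂⌈/2^⌉⌉ x i) ⟩
  ⌈log₂ x ⌉ ∸ i ∸ 1          ≡⟨ ∸-+-assoc ⌈log₂ x ⌉ i 1 ⟩
  ⌈log₂ x ⌉ ∸ (i + 1)        ≡⟨ cong (⌈log₂ x ⌉ ∸_) (+-comm i 1) ⟩
  ⌈log₂ x ⌉ ∸ suc i          ∎
  where open ≡-Reasoning

⌈log₂⌉≡0⇒≤1 : ∀ {s} → ⌈log₂ s ⌉ ≡ 0 → s ≤ 1
⌈log₂⌉≡0⇒≤1 {zero}        _  = z≤n
⌈log₂⌉≡0⇒≤1 {suc zero}    _  = ≤-refl
⌈log₂⌉≡0⇒≤1 {suc (suc s)} eq with () ← subst (1 ≤_) eq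
  (subst (_≤ ⌈log₂ suc (suc s) ⌉) (⌈log₂2^n⌉≡n 1) (⌈log₂⌉-mono-≤ {2} {suc (suc s)} (s≤s (s≤s z≤n))))

≤1⇒⌈log₂⌉≡0 : ∀ {s} → s ≤ 1 → ⌈log₂ s ⌉ ≡ 0
≤1⇒⌈log₂⌉≡0 {s} s≤1 = n≤0⇒n≡0 (subst (⌈log₂ s ⌉ ≤_) (⌈log₂2^n⌉≡n 0) (⌈log₂⌉-mono-≤ s≤1))

⌈/2^⌉≤1⇔⌈log₂⌉≤ : ∀ x k → ⌈ x /2^ k ⌉ ≤ 1 ⇔ ⌈log₂ x ⌉ ≤ k
⌈/2^⌉≤1⇔⌈log₂⌉≤ x k = mk⇔
  (λ ≤1 → m∸n≡0⇒m≤n (trans (sym (⌈log₂⌈/2^⌉⌉ x k)) (≤1⇒⌈log₂⌉≡0 ≤1)))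
  (λ log≤k → ⌈log₂⌉≡0⇒≤1 (trans (⌈log₂⌈/2^⌉⌉ x k) (m≤n⇒m∸n≡0 log≤k)))

query-or-verdict : ∀ o → (∃[ F ] o ≡ query F) ⊎ IsVerdict o
query-or-verdict (query F) = inj₁ (F , refl)
query-or-verdict YES       = inj₂ tt
query-or-verdict NO        = inj₂ tt

verdict? : ∀ o → Dec (IsVerdict o)
verdict? (query _) = no λ ()
verdict? YES       = yes tt
verdict? NO        = yes tt

YES≢NO : YES ≢ NO
YES≢NO ()

module _ (Alg : Algorithm) (A : Digraph) where

  step-query : ∀ {σ F} → G Alg σ ≡ query F → step Alg A σ ≡ σ ∷ʳ hom F A
  step-query {σ} G-σ with G Alg σ
  step-query refl | query F = refl

  step-verdict : ∀ {σ} → IsVerdict (G Alg σ) → step Alg A σ ≡ σ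
  step-verdict {σ} v with G Alg σ
  ... | YES = refl
  ... | NO  = refl

  path-halted : ∀ {i} → IsVerdict (G Alg (path Alg A i)) → ∀ d → path Alg A (d + i) ≡ path Alg A i
  path-halted v zero    = refl
  path-halted v (suc d) = trans (cong (step Alg A) (path-halted v d)) (step-verdict v)

  verdict-at : ∀ {k i o} → HaltsWithin Alg k A → IsVerdict o → G Alg (path Alg A i) ≡ o →
    G Alg (path Alg A k) ≡ o
  verdict-at {k} {i} (i₀ , i₀≤k , _ , v₀) v G-i = trans (cong (G Alg) path-k≡path-i) G-i
    where
    vᵢ = subst IsVerdict (sym G-i) v
    path-k≡path-i : path Alg A k ≡ path Alg A i
    path-k≡path-i = begin
      path Alg A k              ≡⟨ cong (path Alg A) (m∸n+n≡m i₀≤k) ⟨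
      path Alg A (k ∸ i₀ + i₀)  ≡⟨ path-halted v₀ (k ∸ i₀) ⟩
      path Alg A i₀             ≡⟨ path-halted v₀ i ⟨
      path Alg A (i + i₀)       ≡⟨ cong (path Alg A) (+-comm i i₀) ⟩
      path Alg A (i₀ + i)       ≡⟨ path-halted vᵢ i₀ ⟩
      path Alg A i              ∎
      where open ≡-Reasoning

  accepted-at : ∀ {k} → HaltsWithin Alg k A → Accepts Alg A → G Alg (path Alg A k) ≡ YES
  accepted-at halts (i , _ , G≡YES) = verdict-at {i = i} halts tt G≡YES

  rejected-at : ∀ {k} → HaltsWithin Alg k A → Rejects Alg A → G Alg (path Alg A k) ≡ NO
  rejected-at halts (i , _ , G≡NO) = verdict-at {i = i} halts tt G≡NO

separated-paths-differ : ∀ {Alg k 𝒜 ℬ A B} → IsKQuery k Alg → Separates Alg 𝒜 ℬ → 𝒜 A → ℬ B →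
  path Alg A k ≢ path Alg B k
separated-paths-differ {Alg} {k} {A = A} {B} halts (inj₁ (acc , rej)) a b eq = YES≢NO (begin
  YES                   ≡⟨ accepted-at Alg A (halts A) (acc A a) ⟨
  G Alg (path Alg A k)  ≡⟨ cong (G Alg) eq ⟩
  G Alg (path Alg B k)  ≡⟨ rejected-at Alg B (halts B) (rej B b) ⟩
  NO                    ∎)
  where open ≡-Reasoning
separated-paths-differ {Alg} {k} {A = A} {B} halts (inj₂ (rej , acc)) a b eq = YES≢NO (begin
  YES                   ≡⟨ accepted-at Alg B (halts B) (acc B b) ⟨
  G Alg (path Alg B k)  ≡⟨ cong (G Alg) eq ⟨
  G Alg (path Alg A k)  ≡⟨ rejected-at Alg A (halts A) (rej A a) ⟩
  NO                    ∎)
  where open ≡-Reasoning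

module StateMachine {S : Set} (out : S → Out) (next : S → ℕ → S) where

  Run : S → List ℕ → Set
  Run s []      = ⊤
  Run s (x ∷ σ) = ¬ IsVerdict (out s) × Run (next s x) σ

  Run-++⁻ : ∀ s σ τ → Run s (σ ++ τ) → Run s σ × Run (foldl next s σ) τ
  Run-++⁻ s []      τ r        = tt , r
  Run-++⁻ s (x ∷ σ) τ (nv , r) = let r₁ , r₂ = Run-++⁻ (next s x) σ τ r in (nv , r₁) , r₂

  Run-++⁺ : ∀ s σ τ → Run s σ → Run (foldl next s σ) τ → Run s (σ ++ τ)
  Run-++⁺ s []      τ _        r′ = r′
  Run-++⁺ s (x ∷ σ) τ (nv , r) r′ = nv , Run-++⁺ (next s x) σ τ r r′

  machine : S → Algorithm
  machine s₀ = record
    { 𝒯             = Run s₀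
    ; prefix-closed = λ σ τ → proj₁ ∘ Run-++⁻ s₀ σ τ
    ; G             = out ∘ foldl next s₀
    ; leaf-iff      = λ σ r → halted⇒leaf σ , leaf⇒halted σ r
    }
    where
    halted⇒leaf : ∀ σ → IsVerdict (out (foldl next s₀ σ)) → ∀ τ → Run s₀ (σ ++ τ) → τ ≡ []
    halted⇒leaf σ v []      _ = refl
    halted⇒leaf σ v (x ∷ τ) r = ⊥-elim (proj₁ (proj₂ (Run-++⁻ s₀ σ (x ∷ τ) r)) v)
    leaf⇒halted : ∀ σ → Run s₀ σ → (∀ τ → Run s₀ (σ ++ τ) → τ ≡ []) → IsVerdict (out (foldl next s₀ σ))
    leaf⇒halted σ r leaf with verdict? (out (foldl next s₀ σ))
    ... | yes v  = v
    ... | no  nv with () ← leaf [ 0 ] (Run-++⁺ s₀ σ [ 0 ] r (nv , tt))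

  advance : Digraph → S → S
  advance A s with out s
  ... | query F = next s (hom F A)
  ... | YES     = s
  ... | NO      = s

  state : S → Digraph → ℕ → S
  state s₀ A i = fold s₀ (advance A) i

  advance-query : ∀ A s {F} → out s ≡ query F → advance A s ≡ next s (hom F A)
  advance-query A s out-s with out s
  advance-query A s refl | query F = refl

  advance-verdict : ∀ A s → IsVerdict (out s) → advance A s ≡ s
  advance-verdict A s v with out s
  ... | YES = refl
  ... | NO  = refl

  module _ (s₀ : S) (A : Digraph) where

    Tracks : ℕ → List ℕ → Set
    Tracks i σ = Run s₀ σ × foldl next s₀ σ ≡ state s₀ A i

    path-tracks-state : ∀ i → Tracks i (path (machine s₀) A i)
    path-tracks-state zero = tt , refl
    path-tracks-state (suc i) with path-tracks-state i | query-or-verdict (out (state s₀ A i))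
    ... | r , tracks | inj₁ (F , out≡F) =
      subst (Tracks (suc i)) (sym (step-query (machine s₀) A (trans (cong out tracks) out≡F))) (run′ , tracks′)
      where
      σ = path (machine s₀) A i
      x = hom F A
      run′ : Run s₀ (σ ∷ʳ x)
      run′ = Run-++⁺ s₀ σ [ x ] r
        (subst (λ s → Run s [ x ]) (sym tracks) (subst (¬_ ∘ IsVerdict) (sym out≡F) (λ ()) , tt))
      tracks′ : foldl next s₀ (σ ∷ʳ x) ≡ state s₀ A (suc i)
      tracks′ = begin
        foldl next s₀ (σ ∷ʳ x)    ≡⟨ foldl-∷ʳ next s₀ x σ ⟩
        next (foldl next s₀ σ) x  ≡⟨ cong (λ s → next s x) tracks ⟩
        next (state s₀ A i) x     ≡⟨ advance-query A (state s₀ A i) out≡F ⟨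
        advance A (state s₀ A i)  ∎
        where open ≡-Reasoning
    ... | r , tracks | inj₂ v =
      subst (Tracks (suc i)) (sym (step-verdict (machine s₀) A (subst IsVerdict (cong out (sym tracks)) v)))
        (r , trans tracks (sym (advance-verdict A (state s₀ A i) v)))

    machine-halts : ∀ {k} → IsVerdict (out (state s₀ A k)) → HaltsWithin (machine s₀) k A
    machine-halts {k} v = let r , tracks = path-tracks-state k in
      k , ≤-refl , r , subst IsVerdict (cong out (sym tracks)) v

    machine-accepts : ∀ i → out (state s₀ A i) ≡ YES → Accepts (machine s₀) A
    machine-accepts i out≡YES = let r , tracks = path-tracks-state i in i , r , trans (cong out tracks) out≡YES

    machine-rejects : ∀ i → out (state s₀ A i) ≡ NO → Rejects (machine s₀) A
    machine-rejects i out≡NO = let r , tracks = path-tracks-state i in i , r , trans (cong out tracks) out≡NO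

parity : ℕ → Out
parity zero          = YES
parity (suc zero)    = NO
parity (suc (suc m)) = parity m

parity-verdict : ∀ m → IsVerdict (parity m)
parity-verdict zero          = tt
parity-verdict (suc zero)    = tt
parity-verdict (suc (suc m)) = parity-verdict m

parity-even : ∀ {m} → Even m → parity m ≡ YES
parity-even (j , refl) = double j
  where
  double : ∀ j → parity (2 * j) ≡ YES
  double zero    = refl
  double (suc j) = subst (λ x → parity x ≡ YES) (sym (*-suc 2 j)) (double j)

parity-odd : ∀ {m} → Odd m → parity m ≡ NO
parity-odd (j , refl) = double+1 j
  where
  double+1 : ∀ j → parity (suc (2 * j)) ≡ NO
  double+1 zero    = refl
  double+1 (suc j) = subst (λ x → parity (suc x) ≡ NO) (sym (*-suc 2 j)) (double+1 j)

consecutive-parities : ∀ m → (Even m × Odd (suc m)) ⊎ (Odd m × Even (suc m))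
consecutive-parities zero = inj₁ ((0 , refl) , (0 , refl))
consecutive-parities (suc m) with consecutive-parities m
... | inj₁ (_ , odd@(j , e))  = inj₂ (odd , (suc j , trans (cong suc e) (sym (*-suc 2 j))))
... | inj₂ (_ , even@(j , e)) = inj₁ (even , (j , cong suc e))

-- Lower bound

module LowerBound {n k} (Alg : Algorithm) (halts : IsKQuery k Alg)
                   (separates : Separates Alg (𝒟 n) (𝒟′ n)) where

  adjacent-blocks-differ : ∀ {m} → suc m ≤ n → path Alg (block n m) k ≢ path Alg (block n (suc m)) k
  adjacent-blocks-differ {m} m<n with consecutive-parities m
  ... | inj₁ (even , odd) =
    separated-paths-differ halts separates (m , <⇒≤ m<n , even , refl) (suc m , m<n , odd , refl)
  ... | inj₂ (odd , even) =
    ≢-sym (separated-paths-differ halts separates (suc m , m<n , even , refl) (m , <⇒≤ m<n , odd , refl))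

  Window : ℕ → Set
  Window i = ∃[ lo ] ∃[ σ ] (lo + ⌈ suc n /2^ i ⌉ ≤ suc n ×
    (∀ {m} → lo ≤ m → m < lo + ⌈ suc n /2^ i ⌉ → path Alg (block n m) i ≡ σ))

  -- Written without with-abstraction, which makes Agda normalise hom F (block n m) and is prohibitively slow.
  window : ∀ i → Window i
  window zero    = 0 , [] , ≤-refl , λ _ _ → refl
  window (suc i) = let lo , σ , fits , same = window i in
    [ queried lo σ fits same , halted lo σ fits same ]′ (query-or-verdict (G Alg σ))
    where
    s = ⌈ suc n /2^ i ⌉
    Same : ℕ → List ℕ → Set
    Same lo σ = ∀ {m} → lo ≤ m → m < lo + s → path Alg (block n m) i ≡ σ
    halted : ∀ lo σ → lo + s ≤ suc n → Same lo σ → IsVerdict (G Alg σ) → Window (suc i)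
    halted lo σ fits same v = lo , σ , ≤-trans shrink fits , λ {m} lo≤m m<end →
      trans (cong (step Alg (block n m)) (same lo≤m (<-≤-trans m<end shrink))) (step-verdict Alg (block n m) v)
      where shrink = +-monoʳ-≤ lo (⌈n/2⌉≤n s)
    queried : ∀ lo σ → lo + s ≤ suc n → Same lo σ → ∃[ F ] G Alg σ ≡ query F → Window (suc i)
    queried lo σ fits same (F , G≡F) =
      let lo′ , v , lo≤lo′ , fits′ , constant = threshold-halving (hom-block-threshold n F) lo s fits in
      lo′ , σ ∷ʳ v , ≤-trans fits′ fits , λ {m} lo′≤m m<end →
        trans (cong (step Alg (block n m)) (same (≤-trans lo≤lo′ lo′≤m) (<-≤-trans m<end fits′)))
              (trans (step-query Alg (block n m) G≡F) (cong (σ ∷ʳ_) (constant lo′≤m m<end)))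

  lower-bound : ⌈log₂ suc n ⌉ ≤ k
  lower-bound = Equivalence.to (⌈/2^⌉≤1⇔⌈log₂⌉≤ (suc n) k) (≮⇒≥ (collision (window k)))
    where
    s = ⌈ suc n /2^ k ⌉
    collision : Window k → 2 ≤ s → ⊥
    collision (lo , σ , fits , same) 2≤s = adjacent-blocks-differ {lo} (s≤s⁻¹ (≤-trans lo+2≤lo+s fits))
      (trans (same {lo} ≤-refl (m<m+n lo (<-trans (s≤s z≤n) 2≤s))) (sym (same {suc lo} (n≤1+n lo) lo+2≤lo+s)))
      where
      lo+2≤lo+s : suc (suc lo) ≤ lo + s
      lo+2≤lo+s = subst (_≤ lo + s) (+-comm lo 2) (+-monoʳ-≤ lo 2≤s)

-- Binary search

-- A state (lo , s) stands for the candidate interval [lo, lo + s) for m.  For s ≥ 2 the query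
-- C_(2^j) with j = lo + ⌈s/2⌉ - 1 has a positive answer on block n m iff m is in the lower half.
bisect : ℕ × ℕ → Out
bisect (lo , suc (suc r)) = query (dyadicCycle (lo + ⌊ suc r /2⌋))
bisect (lo , _)           = parity lo

narrow : ℕ × ℕ → ℕ → ℕ × ℕ
narrow (lo , s) zero    = lo + ⌊ s /2⌋ , ⌈ s /2⌉
narrow (lo , s) (suc _) = lo , ⌈ s /2⌉

open StateMachine bisect narrow

binarySearch : ℕ → Algorithm
binarySearch n = machine (0 , suc n)

bisect-verdict : ∀ st → proj₂ st ≤ 1 → IsVerdict (bisect st)
bisect-verdict (lo , zero)        _        = parity-verdict lo
bisect-verdict (lo , suc zero)    _        = parity-verdict lo
bisect-verdict (lo , suc (suc r)) (s≤s ())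

size-advance : ∀ A st → proj₂ (advance A st) ≡ ⌈ proj₂ st /2⌉
size-advance A (lo , zero)        = cong proj₂ (advance-verdict A (lo , zero) (parity-verdict lo))
size-advance A (lo , suc zero)    = cong proj₂ (advance-verdict A (lo , suc zero) (parity-verdict lo))
size-advance A (lo , suc (suc r)) = trans (cong proj₂ (advance-query A (lo , suc (suc r)) refl))
  (narrow-size (hom (dyadicCycle (lo + ⌊ suc r /2⌋)) A))
  where
  narrow-size : ∀ x → proj₂ (narrow (lo , suc (suc r)) x) ≡ ⌈ suc (suc r) /2⌉
  narrow-size zero    = refl
  narrow-size (suc _) = refl

state-size≤1 : ∀ {n k} → ⌈log₂ suc n ⌉ ≤ k → ∀ A → proj₂ (state (0 , suc n) A k) ≤ 1
state-size≤1 {n} {k} log≤k A = subst (_≤ 1) (sym (fold-commute proj₂ (size-advance A) (0 , suc n) k))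
  (Equivalence.from (⌈/2^⌉≤1⇔⌈log₂⌉≤ (suc n) k) log≤k)

binarySearch-halts : ∀ {n k} → ⌈log₂ suc n ⌉ ≤ k → IsKQuery k (binarySearch n)
binarySearch-halts {n} log≤k A = machine-halts (0 , suc n) A (bisect-verdict _ (state-size≤1 log≤k A))

Brackets : ℕ → ℕ × ℕ → Set
Brackets m (lo , s) = lo ≤ m × m < lo + s

brackets-advance : ∀ {n m} st → Brackets m st → Brackets m (advance (block n m) st)
brackets-advance {n} {m} (lo , zero) b =
  subst (Brackets m) (sym (advance-verdict (block n m) (lo , zero) (parity-verdict lo))) b
brackets-advance {n} {m} (lo , suc zero) b =
  subst (Brackets m) (sym (advance-verdict (block n m) (lo , suc zero) (parity-verdict lo))) b
brackets-advance {n} {m} (lo , s@(suc (suc r))) (lo≤m , m<end) =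
  subst (Brackets m) (sym (advance-query (block n m) (lo , s) refl))
    (narrowed (hom (dyadicCycle j) (block n m)) refl)
  where
  j = lo + ⌊ suc r /2⌋
  narrowed : ∀ x → hom (dyadicCycle j) (block n m) ≡ x → Brackets m (narrow (lo , s) x)
  narrowed zero    no-hom   = ≤-trans mid≤1+j j<m , subst (m <_) (sym (m+⌊n/2⌋+⌈n/2⌉≡m+n lo s)) m<end
    where
    mid≤1+j : lo + ⌊ s /2⌋ ≤ suc j
    mid≤1+j = subst (lo + ⌊ s /2⌋ ≤_) (+-suc lo _) (+-monoʳ-≤ lo (s≤s (⌊n/2⌋-mono (n≤1+n r))))
    j<m : j < m
    j<m = ≰⇒> λ m≤j → <-irrefl (sym no-hom) (Equivalence.from 0<hom-dyadicCycle-block⇔ m≤j)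
  narrowed (suc _) some-hom = lo≤m , subst (m <_) (sym (+-suc lo _)) (s≤s m≤j)
    where
    m≤j = Equivalence.to 0<hom-dyadicCycle-block⇔ (subst (0 <_) (sym some-hom) (s≤s z≤n))

state-brackets : ∀ {n m} → m ≤ n → ∀ i → Brackets m (state (0 , suc n) (block n m) i)
state-brackets m≤n zero    = z≤n , s≤s m≤n
state-brackets m≤n (suc i) = brackets-advance _ (state-brackets m≤n i)

bisect-final≡parity : ∀ {m} st → Brackets m st → proj₂ st ≤ 1 → bisect st ≡ parity m
bisect-final≡parity {m} (lo , zero)     (lo≤m , m<lo+0) _ =
  ⊥-elim (<⇒≱ (subst (m <_) (+-identityʳ lo) m<lo+0) lo≤m)
bisect-final≡parity {m} (lo , suc zero) (lo≤m , m<lo+1) _ =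
  cong parity (≤-antisym lo≤m (s≤s⁻¹ (subst (m <_) (+-comm lo 1) m<lo+1)))
bisect-final≡parity (lo , suc (suc r)) _ (s≤s ())

binarySearch-separates : ∀ {n k} → ⌈log₂ suc n ⌉ ≤ k → Separates (binarySearch n) (𝒟 n) (𝒟′ n)
binarySearch-separates {n} {k} log≤k = inj₁
  ( (λ { _ (m , m≤n , even , refl) →
           machine-accepts (0 , suc n) (block n m) k (trans (outputs-parity m≤n) (parity-even even)) })
  , (λ { _ (m , m≤n , odd , refl) →
           machine-rejects (0 , suc n) (block n m) k (trans (outputs-parity m≤n) (parity-odd odd)) }))
  where
  outputs-parity : ∀ {m} → m ≤ n → bisect (state (0 , suc n) (block n m) k) ≡ parity m
  outputs-parity {m} m≤n =
    bisect-final≡parity (state (0 , suc n) (block n m) k) (state-brackets m≤n k) (state-size≤1 log≤k (block n m))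

corollary14 : (n k : ℕ) → 1 ≤ k →
    (KSeparable k (𝒟 n) (𝒟′ n) ⇔ (⌈log₂ suc n ⌉ ≤ k))
corollary14 n k _ = mk⇔
  (λ (Alg , halts , separates) → LowerBound.lower-bound Alg halts separates)
  (λ log≤k → binarySearch n , binarySearch-halts log≤k , binarySearch-separates log≤k)
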